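{- Let $P$ be a poset with $n\ge 2$ elements and let $Q$ be the split of $P$. Then \[\operatorname{ldim}_2(Q)-\log n-\tfrac12\log\log n-3\ \le\ \operatorname{ldim}_2(P)\ \le\ 2\operatorname{ldim}_2(Q)-2.\]
   Context: Logarithms are base $2$. The split of $P$ is the two-level poset $Q$ with ground set $P'\cup P''$, where $P'=\{x':x\in P\}$ and $P''=\{x'':x\in P\}$ are disjoint copies of $P$, whose only strict relations are $x'<y''$ whenever $x\le y$ in $P$ (so $P'$ is the set of minimal and $P''$ the set of maximal elements). A partial function $f$ from a poset to a chain is monotone if $x\le y$ with $x,y\in\operatorname{dom}(f)$ implies $f(x)\le f(y)$. A local $2$-realiser of a poset $R$ is a set $\mathcal{R}$ of monotone partial functions from $R$ to the $2$-element chain such that for all $x,y\in R$ with $x\not\ge y$ there is $f\in\mathcal{R}$ with $x,y\in\operatorname{dom}(f)$ and $f(x)<f(y)$; $\mu_{\mathcal{R}}(x)$ is the number of $f\in\mathcal{R}$ with $x\in\operatorname{dom}(f)$; $\operatorname{ldim}_2(R)$ is the minimum over local $2$-realisers of $\max_x\mu_{\mathcal{R}}(x)$. -}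

module Defs where

open import Level using (0ℓ)
open import Data.Nat using (ℕ; zero; suc; _≤_)
open import Data.Bool using (Bool; true; false) renaming (_≤_ to _≤ᵇ_)
open import Data.Maybe using (Maybe; just; nothing)
open import Data.List using (List; []; _∷_)
open import Data.List.Relation.Unary.All using (All)
open import Data.List.Membership.Propositional using (_∈_)
open import Data.Sum using (_⊎_; inj₁; inj₂)
open import Data.Product using (Σ; _×_; ∃)
open import Relation.Binary using (Rel)
open import Relation.Binary.PropositionalEquality using (_≡_)
open import Relation.Nullary using (¬_)

-- A partial function from A to the 2-element chain (false < true),
-- encoded as A → Maybe Bool (nothing = outside the domain).
PartialMap : Set → Set
PartialMap A = A → Maybe Bool

Monotone : {A : Set} → Rel A 0ℓ → PartialMap A → Set
Monotone {A} R f = ∀ {x y : A} {a b : Bool} →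
  R x y → f x ≡ just a → f y ≡ just b → a ≤ᵇ b

IsLocal2Realiser : {A : Set} → Rel A 0ℓ → List (PartialMap A) → Set
IsLocal2Realiser {A} R fs =
  All (Monotone R) fs ×
  (∀ (x y : A) → ¬ R y x →
     ∃ λ f → f ∈ fs × f x ≡ just false × f y ≡ just true)

μ : {A : Set} → List (PartialMap A) → A → ℕ
μ [] x = 0
μ (f ∷ fs) x with f x
... | just _  = suc (μ fs x)
... | nothing = μ fs x

IsLdim2 : {A : Set} → Rel A 0ℓ → ℕ → Set
IsLdim2 {A} R k =
  (Σ (List (PartialMap A)) λ fs → IsLocal2Realiser R fs × (∀ x → μ fs x ≤ k)) ×
  (∀ (fs : List (PartialMap A)) (m : ℕ) →
     IsLocal2Realiser R fs → (∀ x → μ fs x ≤ m) → k ≤ m)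

-- The split of a poset (A, R): ground set A ⊎ A (inj₁ x = x', inj₂ x = x''),
-- order = reflexive closure of x' < y'' whenever x ≤ y.
data Split {A : Set} (R : Rel A 0ℓ) : Rel (A ⊎ A) 0ℓ where
  split-refl : ∀ {z} → Split R z z
  split-up   : ∀ {x y} → R x y → Split R (inj₁ x) (inj₂ y)

-- Upper bound: a local 2-realiser of Q collapses to one of P by sending x to 0 where x'' is
-- sent to 0 and to 1 where x' is sent to 1.  The member separating x' < x'' counts twice in
-- μ(x') + μ(x'') and not at all in the collapsed μ(x), so ldim₂ P ≤ 2 ldim₂ Q − 2.
--
-- Lower bound: run a local 2-realiser of P on both levels, add the member that is 0 on P' and
-- 1 on P'', and separate two elements of one level by the coordinates of distinct words of
-- length m and weight ⌈m/2⌉.  Words of equal weight form an antichain of the cube, so every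
-- pair is separated in both directions, and ldim₂ Q ≤ ldim₂ P + m + 1 once n ≤ C(m, ⌈m/2⌉).
-- For the least such m, C(m−1, ⌈(m−1)/2⌉)² ≥ 4^(m−2) / ⌈(m−1)/2⌉ and 2^⌈(m−1)/2⌉ ≤ n, which
-- together say m − 2 ≤ log n + ½ log log n.

module Submission where

open import Defs
open import Level using (0ℓ)
open import Data.Bool using (Bool; true; false; f≤t; b≤b) renaming (_≤_ to _≤ᵇ_)
open import Data.Bool.Properties using (≤-minimum)
open import Data.Empty using (⊥-elim)
open import Data.Fin as Fin using (Fin; splitAt; join; inject≤)
open import Data.Fin.Properties using (join-splitAt; inject≤-injective)
open import Data.List using (List; []; _∷_; _++_; map; length; allFin)
open import Data.List.Properties using (length-map; length-tabulate)
open import Data.List.Relation.Unary.All as All using (All; _∷_; universal)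
open import Data.List.Relation.Unary.All.Properties using (++⁺; map⁺)
open import Data.List.Relation.Unary.Any using (here; there)
open import Data.List.Membership.Propositional using (_∈_)
open import Data.List.Membership.Propositional.Properties using (∈-map⁺; ∈-++⁺ˡ; ∈-++⁺ʳ; ∈-allFin)
open import Data.Maybe using (Maybe; just; nothing)
open import Data.Nat using (ℕ; zero; suc; _+_; _*_; _∸_; _^_; _≤_; _<_; z≤n; s≤s; _≤?_; ⌈_/2⌉)
open import Data.Nat.Properties
open import Data.Nat.Tactic.RingSolver using (solve-∀)
open import Data.Product using (∃; ∃-syntax; _×_; _,_)
open import Data.Sum using (_⊎_; inj₁; inj₂; [_,_]′; reduce)
open import Data.Vec using (Vec; []; _∷_; replicate; lookup; countᵇ)
open import Data.Vec.Properties using (∷-injectiveˡ; ∷-injectiveʳ)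
open import Function using (_∘_; const; id)
open import Relation.Binary using (Rel; Reflexive; IsPartialOrder)
open import Relation.Binary.PropositionalEquality
open import Relation.Nullary using (¬_; yes; no)
open import Algebra.Properties.CommutativeSemigroup +-commutativeSemigroup using (interchange; xy∙z≈xz∙y)

-- Central binomial coefficients

infix 8 _choose_

_choose_ : ℕ → ℕ → ℕ
n     choose zero  = 1
zero  choose suc k = 0
suc n choose suc k = n choose k + n choose suc k

choose-1 : ∀ n → n choose 1 ≡ n
choose-1 zero    = refl
choose-1 (suc n) = cong suc (choose-1 n)

choose-absorption : ∀ n k → suc k * (suc n choose suc k) ≡ suc n * (n choose k)
choose-absorption zero    zero    = refl
choose-absorption zero    (suc k) = *-zeroʳ (suc (suc k))
choose-absorption (suc n) zero    = trans (+-identityʳ _) (trans (choose-1 (suc (suc n))) (sym (*-identityʳ _)))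
choose-absorption (suc n) (suc k) = begin
  suc (suc k) * (X + Y)                                  ≡⟨ regroup X Y k ⟩
  X + suc k * X + suc (suc k) * Y
    ≡⟨ cong₂ (λ a b → X + a + b) (choose-absorption n k) (choose-absorption n (suc k)) ⟩
  X + suc n * (n choose k) + suc n * (n choose suc k)    ≡⟨ collect (n choose k) (n choose suc k) n ⟩
  suc (suc n) * (n choose k + n choose suc k)            ∎
  where
  open ≡-Reasoning
  X = suc n choose suc k
  Y = suc n choose suc (suc k)
  regroup : ∀ x y k → suc (suc k) * (x + y) ≡ x + suc k * x + suc (suc k) * y
  regroup = solve-∀
  collect : ∀ p q n → p + q + suc n * p + suc n * q ≡ suc (suc n) * (p + q)
  collect = solve-∀

even-central odd-central : ℕ → ℕ
even-central j = (j + j) choose j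
odd-central  j = suc (j + j) choose suc j

odd-central-absorption : ∀ j → suc j * odd-central j ≡ suc (j + j) * even-central j
odd-central-absorption j = choose-absorption (j + j) j

-- Absorption at (2j + 1, j) gives (j + 1) (c + odd-central j) = 2 (j + 1) c for c = C(2j + 1, j).
choose-middle : ∀ j → suc (j + j) choose j ≡ odd-central j
choose-middle j = *-cancelˡ-≡ _ _ (suc j) (+-cancelʳ-≡ _ _ _ (begin
  suc j * c + suc j * c                  ≡⟨ double c j ⟩
  suc (suc (j + j)) * c                  ≡⟨ choose-absorption (suc (j + j)) j ⟨
  suc j * (c + odd-central j)            ≡⟨ *-distribˡ-+ (suc j) c (odd-central j) ⟩
  suc j * c + suc j * odd-central j      ≡⟨ +-comm (suc j * c) _ ⟩
  suc j * odd-central j + suc j * c      ∎))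
  where
  open ≡-Reasoning
  c = suc (j + j) choose j
  double : ∀ c j → suc j * c + suc j * c ≡ suc (suc (j + j)) * c
  double = solve-∀

even-central-suc : ∀ j → even-central (suc j) ≡ odd-central j + odd-central j
even-central-suc j rewrite +-suc j j = cong (_+ odd-central j) (choose-middle j)

even-central≤odd-central : ∀ j → even-central j ≤ odd-central j
even-central≤odd-central j = *-cancelˡ-≤ (suc j) (begin
  suc j * even-central j          ≤⟨ *-monoˡ-≤ (even-central j) (s≤s (m≤m+n j j)) ⟩
  suc (j + j) * even-central j    ≡⟨ odd-central-absorption j ⟨
  suc j * odd-central j           ∎)
  where open ≤-Reasoning

2^j≤even-central : ∀ j → 2 ^ j ≤ even-central j
2^j≤even-central zero    = ≤-refl
2^j≤even-central (suc j) = begin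
  2 ^ j + (2 ^ j + 0)             ≡⟨ cong (2 ^ j +_) (+-identityʳ (2 ^ j)) ⟩
  2 ^ j + 2 ^ j                   ≤⟨ +-mono-≤ bound bound ⟩
  odd-central j + odd-central j   ≡⟨ even-central-suc j ⟨
  even-central (suc j)            ∎
  where
  open ≤-Reasoning
  bound = ≤-trans (2^j≤even-central j) (even-central≤odd-central j)

odd-central-triples : ∀ j → 3 * odd-central j ≤ odd-central (suc j)
odd-central-triples j = *-cancelˡ-≤ (suc (suc j)) (begin
  suc (suc j) * (3 * b)                                 ≤⟨ m≤m+n _ (j * b) ⟩
  suc (suc j) * (3 * b) + j * b                         ≡⟨ expand j b ⟨
  suc (suc j + suc j) * (b + b)                         ≡⟨ cong (suc (suc j + suc j) *_) (even-central-suc j) ⟨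
  suc (suc j + suc j) * even-central (suc j)            ≡⟨ odd-central-absorption (suc j) ⟨
  suc (suc j) * odd-central (suc j)                     ∎)
  where
  open ≤-Reasoning
  b = odd-central j
  expand : ∀ j b → suc (suc j + suc j) * (b + b) ≡ suc (suc j) * (3 * b) + j * b
  expand = solve-∀

2^[1+j]≤1+odd-central : ∀ j → 2 ^ suc j ≤ suc (odd-central j)
2^[1+j]≤1+odd-central zero    = ≤-refl
2^[1+j]≤1+odd-central (suc j) = begin
  2 * 2 ^ suc j                 ≤⟨ *-monoʳ-≤ 2 (2^[1+j]≤1+odd-central j) ⟩
  2 * suc b                     ≤⟨ two-step b 0<b ⟩
  suc (3 * b)                   ≤⟨ s≤s (odd-central-triples j) ⟩
  suc (odd-central (suc j))     ∎
  where
  open ≤-Reasoning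
  b = odd-central j
  0<b : 0 < b
  0<b = ≤-trans (m^n>0 2 j) (≤-trans (2^j≤even-central j) (even-central≤odd-central j))
  two-step : ∀ b → 0 < b → 2 * suc b ≤ suc (3 * b)
  two-step (suc b) _ = ≤-trans (m≤m+n _ b) (≤-reflexive (regroup b))
    where
    regroup : ∀ b → 2 * suc (suc b) + b ≡ suc (3 * suc b)
    regroup = solve-∀

16^j≤[1+j]*odd-central² : ∀ j → 4 ^ (j + j) ≤ suc j * (odd-central j * odd-central j)
16^j≤[1+j]*odd-central² zero    = ≤-refl
16^j≤[1+j]*odd-central² (suc j) = *-cancelˡ-≤ (suc (suc j)) (begin
  suc (suc j) * 4 ^ (suc j + suc j)              ≡⟨ cong (λ e → suc (suc j) * 4 ^ suc e) (+-suc j j) ⟩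
  suc (suc j) * (4 * (4 * 4 ^ (j + j)))
    ≤⟨ *-monoʳ-≤ (suc (suc j)) (*-monoʳ-≤ 4 (*-monoʳ-≤ 4 (16^j≤[1+j]*odd-central² j))) ⟩
  suc (suc j) * (4 * (4 * (suc j * (b * b))))    ≤⟨ m≤m+n _ (4 * (b * b)) ⟩
  suc (suc j) * (4 * (4 * (suc j * (b * b)))) + 4 * (b * b) ≡⟨ expand j b ⟨
  (suc (suc j + suc j) * (b + b)) * (suc (suc j + suc j) * (b + b))     ≡⟨ cong (λ x → x * x) step ⟩
  (suc (suc j) * odd-central (suc j)) * (suc (suc j) * odd-central (suc j)) ≡⟨ square-product (suc (suc j)) (odd-central (suc j)) ⟩
  suc (suc j) * (suc (suc j) * (odd-central (suc j) * odd-central (suc j))) ∎)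
  where
  open ≤-Reasoning
  b = odd-central j
  step : suc (suc j + suc j) * (b + b) ≡ suc (suc j) * odd-central (suc j)
  step = trans (cong (suc (suc j + suc j) *_) (sym (even-central-suc j))) (sym (odd-central-absorption (suc j)))
  expand : ∀ j b → (suc (suc j + suc j) * (b + b)) * (suc (suc j + suc j) * (b + b))
                 ≡ suc (suc j) * (4 * (4 * (suc j * (b * b)))) + 4 * (b * b)
  expand = solve-∀
  square-product : ∀ x y → (x * y) * (x * y) ≡ x * (x * (y * y))
  square-product = solve-∀

4^[1+2j]≤[1+j]*even-central[1+j]² : ∀ j → 4 ^ suc (j + j) ≤ suc j * (even-central (suc j) * even-central (suc j))
4^[1+2j]≤[1+j]*even-central[1+j]² j = begin
  4 * 4 ^ (j + j)                      ≤⟨ *-monoʳ-≤ 4 (16^j≤[1+j]*odd-central² j) ⟩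
  4 * (suc j * (b * b))                ≡⟨ regroup j b ⟩
  suc j * ((b + b) * (b + b))          ≡⟨ cong (λ a → suc j * (a * a)) (even-central-suc j) ⟨
  suc j * (even-central (suc j) * even-central (suc j)) ∎
  where
  open ≤-Reasoning
  b = odd-central j
  regroup : ∀ j b → 4 * (suc j * (b * b)) ≡ suc j * ((b + b) * (b + b))
  regroup = solve-∀

data EvenOrOdd : ℕ → Set where
  even : ∀ j → EvenOrOdd (j + j)
  odd  : ∀ j → EvenOrOdd (suc (j + j))

evenOrOdd : ∀ m → EvenOrOdd m
evenOrOdd zero = even zero
evenOrOdd (suc m) with evenOrOdd m
... | even j = odd j
... | odd j  = subst EvenOrOdd (cong suc (+-suc j j)) (even (suc j))

central : ℕ → ℕ
central m = m choose ⌈ m /2⌉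

central-even : ∀ j → central (j + j) ≡ even-central j
central-even j = cong ((j + j) choose_) (sym (n≡⌈n+n/2⌉ j))

central-odd : ∀ j → central (suc (j + j)) ≡ odd-central j
central-odd j = cong (λ k → suc (j + j) choose suc k) (sym (n≡⌊n+n/2⌋ j))

2^⌈m/2⌉≤1+central : ∀ m → 2 ^ ⌈ m /2⌉ ≤ suc (central m)
2^⌈m/2⌉≤1+central m with evenOrOdd m
... | even j rewrite central-even j | sym (n≡⌈n+n/2⌉ j) = m≤n⇒m≤1+n (2^j≤even-central j)
... | odd j  rewrite central-odd j | sym (n≡⌊n+n/2⌋ j) = 2^[1+j]≤1+odd-central j

4^m≤⌈[1+m]/2⌉*central[1+m]² : ∀ m → 4 ^ m ≤ ⌈ suc m /2⌉ * (central (suc m) * central (suc m))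
4^m≤⌈[1+m]/2⌉*central[1+m]² m with evenOrOdd m
... | even j rewrite central-odd j | sym (n≡⌊n+n/2⌋ j) = 16^j≤[1+j]*odd-central² j
... | odd j  = subst₂ (λ L c → 4 ^ suc (j + j) ≤ L * (c * c))
                      (cong suc (n≡⌈n+n/2⌉ j))
                      (trans (sym (central-even (suc j))) (cong (central ∘ suc) (+-suc j j)))
                      (4^[1+2j]≤[1+j]*even-central[1+j]² j)

crossing : ∀ (f : ℕ → ℕ) {n} k → f 0 < n → n ≤ f k → ∃[ i ] f i < n × n ≤ f (suc i)
crossing f zero    f0<n n≤f0 = ⊥-elim (<⇒≱ f0<n n≤f0)
crossing f (suc k) f0<n n≤fk+1 with _ ≤? f k
... | yes n≤fk = crossing f k f0<n n≤fk
... | no  n≰fk = k , ≰⇒> n≰fk , n≤fk+1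

n<2^n : ∀ n → n < 2 ^ n
n<2^n zero    = s≤s z≤n
n<2^n (suc n) = begin-strict
  suc n               <⟨ s≤s (n<2^n n) ⟩
  suc (2 ^ n)         ≤⟨ +-monoˡ-≤ (2 ^ n) (m^n>0 2 n) ⟩
  2 ^ n + 2 ^ n       ≡⟨ cong (2 ^ n +_) (+-identityʳ (2 ^ n)) ⟨
  2 ^ suc n           ∎
  where open ≤-Reasoning

2^4^d≤n^n² : ∀ {n} d L → 4 ^ d ≤ L * (n * n) → 2 ^ L ≤ n → 2 ^ (4 ^ d) ≤ n ^ (n * n)
2^4^d≤n^n² {n} d L 4^d≤Ln² 2^L≤n = begin
  2 ^ (4 ^ d)           ≤⟨ ^-monoʳ-≤ 2 4^d≤Ln² ⟩
  2 ^ (L * (n * n))     ≡⟨ ^-*-assoc 2 L (n * n) ⟨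
  (2 ^ L) ^ (n * n)     ≤⟨ ^-monoˡ-≤ (n * n) 2^L≤n ⟩
  n ^ (n * n)           ∎
  where open ≤-Reasoning

n≤central[1+2n] : ∀ n → n ≤ central (suc (n + n))
n≤central[1+2n] n = begin
  n                         ≤⟨ <⇒≤ (n<2^n n) ⟩
  2 ^ n                     ≤⟨ 2^j≤even-central n ⟩
  even-central n            ≤⟨ even-central≤odd-central n ⟩
  odd-central n             ≡⟨ central-odd n ⟨
  central (suc (n + n))     ∎
  where open ≤-Reasoning

central-length : ∀ n → 2 ≤ n → ∃[ m ] n ≤ central m × 2 ^ (4 ^ (m ∸ 2)) ≤ n ^ (n * n)
central-length n 2≤n with crossing (central ∘ suc) (n + n) 2≤n (n≤central[1+2n] n)
... | i , c<n , n≤central[2+i] = suc (suc i) , n≤central[2+i] , 2^4^d≤n^n² i L 4^i≤Ln² 2^L≤n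
  where
  L = ⌈ suc i /2⌉
  4^i≤Ln² : 4 ^ i ≤ L * (n * n)
  4^i≤Ln² = ≤-trans (4^m≤⌈[1+m]/2⌉*central[1+m]² i) (*-monoʳ-≤ L (*-mono-≤ (<⇒≤ c<n) (<⇒≤ c<n)))
  2^L≤n : 2 ^ L ≤ n
  2^L≤n = ≤-trans (2^⌈m/2⌉≤1+central (suc i)) c<n

-- Constant-weight codes

weight : ∀ {m} → Vec Bool m → ℕ
weight = countᵇ id

Separates : ∀ {m} → Vec Bool m → Vec Bool m → Set
Separates {m} u v = ∃[ i ] lookup u i ≡ false × lookup v i ≡ true

separates-of-weight≤ : ∀ {m} (u v : Vec Bool m) → weight u ≤ weight v → u ≢ v → Separates u v
separates-of-weight≤ []          []          _   u≢v = ⊥-elim (u≢v refl)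
separates-of-weight≤ (false ∷ u) (true ∷ v)  _   _   = Fin.zero , refl , refl
separates-of-weight≤ (true ∷ u)  (true ∷ v)  (s≤s w≤) u≢v with separates-of-weight≤ u v w≤ (u≢v ∘ cong (true ∷_))
... | i , ui , vi = Fin.suc i , ui , vi
separates-of-weight≤ (false ∷ u) (false ∷ v) w≤ u≢v with separates-of-weight≤ u v w≤ (u≢v ∘ cong (false ∷_))
... | i , ui , vi = Fin.suc i , ui , vi
separates-of-weight≤ (true ∷ u)  (false ∷ v) w< _ with separates-of-weight≤ u v (<⇒≤ w<) (λ { refl → <-irrefl refl w< })
... | i , ui , vi = Fin.suc i , ui , vi

code : ∀ m w → Fin (m choose w) → Vec Bool m
code-pascal : ∀ m w → Fin (m choose w) ⊎ Fin (m choose suc w) → Vec Bool (suc m)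

code m       zero    _ = replicate m false
code zero    (suc w) ()
code (suc m) (suc w)   = code-pascal m w ∘ splitAt (m choose w)

code-pascal m w = [ (true ∷_) ∘ code m w , (false ∷_) ∘ code m (suc w) ]′

weight-replicate-false : ∀ m → weight (replicate m false) ≡ 0
weight-replicate-false zero    = refl
weight-replicate-false (suc m) = weight-replicate-false m

weight-code : ∀ m w p → weight (code m w p) ≡ w
weight-code m       zero    p = weight-replicate-false m
weight-code (suc m) (suc w) p with splitAt (m choose w) p
... | inj₁ q = cong suc (weight-code m w q)
... | inj₂ q = weight-code m (suc w) q

splitAt-injective : ∀ m {n} {p q : Fin (m + n)} → splitAt m p ≡ splitAt m q → p ≡ q
splitAt-injective m {n} {p} {q} e =
  trans (sym (join-splitAt m n p)) (trans (cong (join m n) e) (join-splitAt m n q))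

code-injective : ∀ m w {p q} → code m w p ≡ code m w q → p ≡ q
code-injective m       zero    {Fin.zero} {Fin.zero} _ = refl
code-injective (suc m) (suc w) e = splitAt-injective (m choose w) (code-pascal-injective _ _ e)
  where
  code-pascal-injective : ∀ s t → code-pascal m w s ≡ code-pascal m w t → s ≡ t
  code-pascal-injective (inj₁ x) (inj₁ y) e = cong inj₁ (code-injective m w (∷-injectiveʳ e))
  code-pascal-injective (inj₂ x) (inj₂ y) e = cong inj₂ (code-injective m (suc w) (∷-injectiveʳ e))
  code-pascal-injective (inj₁ x) (inj₂ y) e with ∷-injectiveˡ e
  ... | ()
  code-pascal-injective (inj₂ x) (inj₁ y) e with ∷-injectiveˡ e
  ... | ()

codeword : ∀ {n} m w → n ≤ m choose w → Fin n → Vec Bool m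
codeword m w n≤ x = code m w (inject≤ x n≤)

codewords-separate : ∀ {n} m w (n≤ : n ≤ m choose w) {x y : Fin n} → x ≢ y →
                     Separates (codeword m w n≤ x) (codeword m w n≤ y)
codewords-separate m w n≤ {x} {y} x≢y =
  separates-of-weight≤ _ _
    (≤-reflexive (trans (weight-code m w _) (sym (weight-code m w _))))
    (x≢y ∘ inject≤-injective n≤ n≤ x y ∘ code-injective m w)

-- Counting domains

inDomain : Maybe Bool → ℕ
inDomain (just _) = 1
inDomain nothing  = 0

module _ {A : Set} where

  μ-∷ : ∀ (f : PartialMap A) fs x → μ (f ∷ fs) x ≡ inDomain (f x) + μ fs x
  μ-∷ f fs x with f x
  ... | just _  = refl
  ... | nothing = refl

  μ-++ : ∀ (fs gs : List (PartialMap A)) x → μ (fs ++ gs) x ≡ μ fs x + μ gs x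
  μ-++ []       gs x = refl
  μ-++ (f ∷ fs) gs x = begin
    μ (f ∷ fs ++ gs) x                    ≡⟨ μ-∷ f (fs ++ gs) x ⟩
    inDomain (f x) + μ (fs ++ gs) x       ≡⟨ cong (inDomain (f x) +_) (μ-++ fs gs x) ⟩
    inDomain (f x) + (μ fs x + μ gs x)    ≡⟨ +-assoc (inDomain (f x)) _ _ ⟨
    inDomain (f x) + μ fs x + μ gs x      ≡⟨ cong (_+ μ gs x) (μ-∷ f fs x) ⟨
    μ (f ∷ fs) x + μ gs x                 ∎
    where open ≡-Reasoning

  μ≤length : ∀ (fs : List (PartialMap A)) x → μ fs x ≤ length fs
  μ≤length []       x = z≤n
  μ≤length (f ∷ fs) x with f x
  ... | just _  = s≤s (μ≤length fs x)
  ... | nothing = m≤n⇒m≤1+n (μ≤length fs x)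

module _ {A B : Set} (φ : PartialMap B → PartialMap A) {z : A} where

  μ-map : ∀ {b} → (∀ g → φ g z ≡ g b) → ∀ gs → μ (map φ gs) z ≡ μ gs b
  μ-map         eq []       = refl
  μ-map {b = b} eq (g ∷ gs) = begin
    μ (φ g ∷ map φ gs) z                  ≡⟨ μ-∷ (φ g) (map φ gs) z ⟩
    inDomain (φ g z) + μ (map φ gs) z     ≡⟨ cong₂ _+_ (cong inDomain (eq g)) (μ-map eq gs) ⟩
    inDomain (g b) + μ gs b               ≡⟨ μ-∷ g gs b ⟨
    μ (g ∷ gs) b                          ∎
    where open ≡-Reasoning

  μ-map-nothing : (∀ g → φ g z ≡ nothing) → ∀ gs → μ (map φ gs) z ≡ 0
  μ-map-nothing eq []       = refl
  μ-map-nothing eq (g ∷ gs) = trans (μ-∷ (φ g) (map φ gs) z) (cong₂ _+_ (cong inDomain (eq g)) (μ-map-nothing eq gs))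

  module _ {a b : B} (bound : ∀ g → inDomain (φ g z) ≤ inDomain (g a) + inDomain (g b)) where

    private
      μ-pair-∷ : ∀ g gs → μ (g ∷ gs) a + μ (g ∷ gs) b ≡ (inDomain (g a) + inDomain (g b)) + (μ gs a + μ gs b)
      μ-pair-∷ g gs = trans (cong₂ _+_ (μ-∷ g gs a) (μ-∷ g gs b))
                            (interchange (inDomain (g a)) (μ gs a) (inDomain (g b)) (μ gs b))

    μ-map-≤ : ∀ gs → μ (map φ gs) z ≤ μ gs a + μ gs b
    μ-map-≤ []       = z≤n
    μ-map-≤ (g ∷ gs) = begin
      μ (map φ (g ∷ gs)) z                                  ≡⟨ μ-∷ (φ g) (map φ gs) z ⟩
      inDomain (φ g z) + μ (map φ gs) z                     ≤⟨ +-mono-≤ (bound g) (μ-map-≤ gs) ⟩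
      (inDomain (g a) + inDomain (g b)) + (μ gs a + μ gs b) ≡⟨ μ-pair-∷ g gs ⟨
      μ (g ∷ gs) a + μ (g ∷ gs) b                           ∎
      where open ≤-Reasoning

    μ-map-+2 : ∀ {g gs} → g ∈ gs → inDomain (φ g z) + 2 ≤ inDomain (g a) + inDomain (g b) →
               μ (map φ gs) z + 2 ≤ μ gs a + μ gs b
    μ-map-+2 {g} {g ∷ gs} (here refl) gap = begin
      μ (map φ (g ∷ gs)) z + 2                              ≡⟨ cong (_+ 2) (μ-∷ (φ g) (map φ gs) z) ⟩
      inDomain (φ g z) + μ (map φ gs) z + 2                 ≡⟨ xy∙z≈xz∙y (inDomain (φ g z)) _ 2 ⟩
      inDomain (φ g z) + 2 + μ (map φ gs) z                 ≤⟨ +-mono-≤ gap (μ-map-≤ gs) ⟩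
      (inDomain (g a) + inDomain (g b)) + (μ gs a + μ gs b) ≡⟨ μ-pair-∷ g gs ⟨
      μ (g ∷ gs) a + μ (g ∷ gs) b                           ∎
      where open ≤-Reasoning
    μ-map-+2 {g} {h ∷ gs} (there g∈gs) gap = begin
      μ (map φ (h ∷ gs)) z + 2                              ≡⟨ cong (_+ 2) (μ-∷ (φ h) (map φ gs) z) ⟩
      inDomain (φ h z) + μ (map φ gs) z + 2                 ≡⟨ +-assoc (inDomain (φ h z)) _ 2 ⟩
      inDomain (φ h z) + (μ (map φ gs) z + 2)               ≤⟨ +-mono-≤ (bound h) (μ-map-+2 g∈gs gap) ⟩
      (inDomain (h a) + inDomain (h b)) + (μ gs a + μ gs b) ≡⟨ μ-pair-∷ h gs ⟨
      μ (h ∷ gs) a + μ (h ∷ gs) b                           ∎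
      where open ≤-Reasoning

-- From P to its split

module _ {A : Set} where

  doubled : PartialMap A → PartialMap (A ⊎ A)
  doubled f = f ∘ reduce

  onLower onUpper : PartialMap A → PartialMap (A ⊎ A)
  onLower f = [ f , const nothing ]′
  onUpper f = [ const nothing , f ]′

  levels : PartialMap (A ⊎ A)
  levels = [ const (just false) , const (just true) ]′

  coordinate : ∀ {m} → (A → Vec Bool m) → Fin m → PartialMap A
  coordinate c i x = just (lookup (c x) i)

  coordinates : ∀ {m} → (A → Vec Bool m) → List (PartialMap A)
  coordinates {m} c = map (coordinate c) (allFin m)

  lowerCoordinates upperCoordinates : ∀ {m} → (A → Vec Bool m) → List (PartialMap (A ⊎ A))
  lowerCoordinates c = map onLower (coordinates c)
  upperCoordinates c = map onUpper (coordinates c)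

  splitRealiser : ∀ {m} → List (PartialMap A) → (A → Vec Bool m) → List (PartialMap (A ⊎ A))
  splitRealiser fs c = map doubled fs ++ levels ∷ lowerCoordinates c ++ upperCoordinates c

  μ-levels-∷ : ∀ gs z → μ (levels ∷ gs) z ≡ suc (μ gs z)
  μ-levels-∷ gs (inj₁ _) = refl
  μ-levels-∷ gs (inj₂ _) = refl

  μ-splitRealiser : ∀ {m} fs (c : A → Vec Bool m) z → μ (splitRealiser fs c) z ≤ μ fs (reduce z) + suc m
  μ-splitRealiser {m} fs c z = begin
    μ (splitRealiser fs c) z                                 ≡⟨ μ-++ (map doubled fs) _ z ⟩
    μ (map doubled fs) z + μ (levels ∷ lowers ++ uppers) z   ≡⟨ cong₂ _+_ (μ-map doubled (λ _ → refl) fs) (μ-levels-∷ _ z) ⟩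
    μ fs (reduce z) + suc (μ (lowers ++ uppers) z)           ≤⟨ +-monoʳ-≤ (μ fs (reduce z)) (s≤s μ-coordinates≤m) ⟩
    μ fs (reduce z) + suc m                                  ∎
    where
    open ≤-Reasoning
    cs = coordinates c
    lowers = lowerCoordinates c
    uppers = upperCoordinates c
    μ-coordinates : ∀ z → μ (lowers ++ uppers) z ≡ μ cs (reduce z)
    μ-coordinates (inj₁ x) = trans (μ-++ lowers uppers (inj₁ x))
      (trans (cong₂ _+_ (μ-map onLower (λ _ → refl) cs) (μ-map-nothing onUpper (λ _ → refl) cs)) (+-identityʳ _))
    μ-coordinates (inj₂ x) = trans (μ-++ lowers uppers (inj₂ x))
      (cong₂ _+_ (μ-map-nothing onLower (λ _ → refl) cs) (μ-map onUpper (λ _ → refl) cs))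
    μ-coordinates≤m : μ (lowers ++ uppers) z ≤ m
    μ-coordinates≤m = begin
      μ (lowers ++ uppers) z    ≡⟨ μ-coordinates z ⟩
      μ cs (reduce z)           ≤⟨ μ≤length cs (reduce z) ⟩
      length cs                 ≡⟨ trans (length-map _ (allFin m)) (length-tabulate id) ⟩
      m                         ∎

equal-values⇒≤ᵇ : ∀ {v : Maybe Bool} {a b} → v ≡ just a → v ≡ just b → a ≤ᵇ b
equal-values⇒≤ᵇ refl refl = b≤b

module _ {A : Set} (R : Rel A 0ℓ) where

  monotone-split : ∀ {g : PartialMap (A ⊎ A)} →
                   (∀ {x y a b} → R x y → g (inj₁ x) ≡ just a → g (inj₂ y) ≡ just b → a ≤ᵇ b) →
                   Monotone (Split R) g
  monotone-split up split-refl   = equal-values⇒≤ᵇ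
  monotone-split up (split-up r) = up r

  doubled-monotone : ∀ {f} → Monotone R f → Monotone (Split R) (doubled f)
  doubled-monotone mono = monotone-split mono

  onLower-monotone : ∀ f → Monotone (Split R) (onLower f)
  onLower-monotone f = monotone-split (λ _ _ ())

  onUpper-monotone : ∀ f → Monotone (Split R) (onUpper f)
  onUpper-monotone f = monotone-split (λ _ ())

  levels-monotone : Monotone (Split R) levels
  levels-monotone = monotone-split (λ { _ refl refl → f≤t })

  module _ {m} {fs : List (PartialMap A)} {c : A → Vec Bool m} where

    private
      coordinate∈ : ∀ i → coordinate c i ∈ coordinates c
      coordinate∈ i = ∈-map⁺ (coordinate c) (∈-allFin i)

    splitRealiser-isLocal2Realiser : IsLocal2Realiser R fs → (∀ {x y} → x ≢ y → Separates (c x) (c y)) →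
                                     IsLocal2Realiser (Split R) (splitRealiser fs c)
    splitRealiser-isLocal2Realiser (mono , realises) separates = monotone , separating
      where
      monotone : All (Monotone (Split R)) (splitRealiser fs c)
      monotone = ++⁺ (map⁺ (All.map doubled-monotone mono))
                     (levels-monotone ∷ ++⁺ (map⁺ (universal onLower-monotone (coordinates c)))
                                            (map⁺ (universal onUpper-monotone (coordinates c))))
      separating : ∀ z w → ¬ Split R w z → ∃ λ g → g ∈ splitRealiser fs c × g z ≡ just false × g w ≡ just true
      separating (inj₁ x) (inj₂ y) _ = levels , ∈-++⁺ʳ (map doubled fs) (here refl) , refl , refl
      separating (inj₂ x) (inj₁ y) y'≰x'' with realises x y (λ r → y'≰x'' (split-up r))
      ... | f , f∈fs , fx , fy = doubled f , ∈-++⁺ˡ (∈-map⁺ doubled f∈fs) , fx , fy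
      separating (inj₁ x) (inj₁ y) y'≰x' with separates (λ { refl → y'≰x' split-refl })
      ... | i , cxi , cyi = onLower (coordinate c i) ,
                            ∈-++⁺ʳ (map doubled fs) (there (∈-++⁺ˡ (∈-map⁺ onLower (coordinate∈ i)))) ,
                            cong just cxi , cong just cyi
      separating (inj₂ x) (inj₂ y) y''≰x'' with separates (λ { refl → y''≰x'' split-refl })
      ... | i , cxi , cyi = onUpper (coordinate c i) ,
                            ∈-++⁺ʳ (map doubled fs) (there (∈-++⁺ʳ (lowerCoordinates c) (∈-map⁺ onUpper (coordinate∈ i)))) ,
                            cong just cxi , cong just cyi

-- From the split to P

-- combine (g x') (g x''): 0 if g x'' = 0, 1 if g x' = 1 (for monotone g these exclude each other,
-- as x' < x''), and undefined otherwise.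
combine : Maybe Bool → Maybe Bool → Maybe Bool
combine _           (just false) = just false
combine (just true) _            = just true
combine _           _            = nothing

combine-true : ∀ u v → combine u v ≡ just true → u ≡ just true
combine-true (just true)  _           _ = refl
combine-true (just false) (just true) ()
combine-true (just false) nothing     ()
combine-true nothing      (just true) ()
combine-true nothing      nothing     ()

combine-false : ∀ u v → combine u v ≡ just false → v ≡ just false
combine-false _            (just false) _ = refl
combine-false (just true)  (just true)  ()
combine-false (just true)  nothing      ()
combine-false (just false) (just true)  ()
combine-false (just false) nothing      ()
combine-false nothing      (just true)  ()
combine-false nothing      nothing      ()

combine-true-intro : ∀ {u v} → u ≡ just true → v ≢ just false → combine u v ≡ just true
combine-true-intro {v = just true}  refl _  = refl
combine-true-intro {v = just false} refl v≢ = ⊥-elim (v≢ refl)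
combine-true-intro {v = nothing}    refl _  = refl

inDomain-combine : ∀ u v → inDomain (combine u v) ≤ inDomain u + inDomain v
inDomain-combine u            (just false) = m≤n+m 1 (inDomain u)
inDomain-combine (just true)  (just true)  = s≤s z≤n
inDomain-combine (just true)  nothing      = s≤s z≤n
inDomain-combine (just false) (just true)  = z≤n
inDomain-combine (just false) nothing      = z≤n
inDomain-combine nothing      (just true)  = z≤n
inDomain-combine nothing      nothing      = z≤n

module _ {A : Set} (R : Rel A 0ℓ) where

  collapse : PartialMap (A ⊎ A) → PartialMap A
  collapse g x = combine (g (inj₁ x)) (g (inj₂ x))

  collapse-monotone : ∀ {g} → Monotone (Split R) g → Monotone R (collapse g)
  collapse-monotone mono {a = false} {b}        _ _ _ = ≤-minimum b
  collapse-monotone mono {a = true}  {b = true} _ _ _ = b≤b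
  collapse-monotone {g} mono {x} {y} {true} {false} r gx gy with
    mono (split-up r) (combine-true (g (inj₁ x)) _ gx) (combine-false (g (inj₁ y)) _ gy)
  ... | ()

  collapse-isLocal2Realiser : Reflexive R → ∀ {gs} → IsLocal2Realiser (Split R) gs →
                              IsLocal2Realiser R (map collapse gs)
  collapse-isLocal2Realiser refl-R {gs} (mono , realises) = map⁺ (All.map collapse-monotone mono) , separating
    where
    separating : ∀ x y → ¬ R y x → ∃ λ f → f ∈ map collapse gs × f x ≡ just false × f y ≡ just true
    separating x y y≰x with realises (inj₂ x) (inj₁ y) (λ { (split-up r) → y≰x r })
    ... | g , g∈gs , gx″ , gy′ =
      collapse g , ∈-map⁺ collapse g∈gs , cong (combine _) gx″ , combine-true-intro gy′ gy″≢false
      where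
      gy″≢false : g (inj₂ y) ≢ just false
      gy″≢false gy″ with All.lookup mono g∈gs (split-up refl-R) gy′ gy″
      ... | ()

  μ-collapse : ∀ {gs} → IsLocal2Realiser (Split R) gs →
               ∀ x → μ (map collapse gs) x + 2 ≤ μ gs (inj₁ x) + μ gs (inj₂ x)
  μ-collapse (_ , realises) x with realises (inj₁ x) (inj₂ x) (λ ())
  ... | g , g∈gs , gx′ , gx″ = μ-map-+2 collapse (λ g → inDomain-combine (g (inj₁ x)) (g (inj₂ x))) g∈gs gap
    where
    gap : inDomain (collapse g x) + 2 ≤ inDomain (g (inj₁ x)) + inDomain (g (inj₂ x))
    gap rewrite gx′ | gx″ = ≤-refl

-- ldim₂ of P and of its split

module _ {A : Set} {R : Rel A 0ℓ} {kP kQ : ℕ} where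

  ldim-split≤ldim+1+ : IsLdim2 R kP → IsLdim2 (Split R) kQ →
                       ∀ {m} (c : A → Vec Bool m) → (∀ {x y} → x ≢ y → Separates (c x) (c y)) →
                       kQ ≤ kP + suc m
  ldim-split≤ldim+1+ ((fs , realiser , bounded) , _) (_ , minimal) {m} c separates =
    minimal (splitRealiser fs c) (kP + suc m)
      (splitRealiser-isLocal2Realiser R {c = c} realiser separates)
      (λ z → ≤-trans (μ-splitRealiser fs c z) (+-monoˡ-≤ (suc m) (bounded (reduce z))))

  ldim+2≤2*ldim-split : IsLdim2 R kP → IsLdim2 (Split R) kQ → Reflexive R → A → kP + 2 ≤ 2 * kQ
  ldim+2≤2*ldim-split (_ , minimal) ((gs , realiser , bounded) , _) refl-R a = begin
    kP + 2                    ≤⟨ +-monoˡ-≤ 2 kP≤2kQ∸2 ⟩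
    (kQ + kQ) ∸ 2 + 2         ≡⟨ m∸n+n≡m (m+n≤o⇒n≤o (μ (map (collapse R) gs) a) (collapsed-bound a)) ⟩
    kQ + kQ                   ≡⟨ cong (kQ +_) (+-identityʳ kQ) ⟨
    2 * kQ                    ∎
    where
    open ≤-Reasoning
    collapsed-bound : ∀ x → μ (map (collapse R) gs) x + 2 ≤ kQ + kQ
    collapsed-bound x = ≤-trans (μ-collapse R realiser x) (+-mono-≤ (bounded (inj₁ x)) (bounded (inj₂ x)))
    kP≤2kQ∸2 : kP ≤ (kQ + kQ) ∸ 2
    kP≤2kQ∸2 = minimal (map (collapse R) gs) ((kQ + kQ) ∸ 2) (collapse-isLocal2Realiser R refl-R realiser)
      (λ x → ≤-trans (≤-reflexive (sym (m+n∸n≡m _ 2))) (∸-monoˡ-≤ 2 (collapsed-bound x)))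

lemma7 : (n : ℕ) → 2 ≤ n → (R : Rel (Fin n) 0ℓ) → IsPartialOrder _≡_ R →
    (kP kQ : ℕ) → IsLdim2 R kP → IsLdim2 (Split R) kQ →
    (2 ^ (2 ^ (2 * (kQ ∸ (kP + 3)))) ≤ n ^ (n * n)) × (kP + 2 ≤ 2 * kQ)
lemma7 n 2≤n R po kP kQ ldimP ldimQ with central-length n 2≤n
... | m , n≤central , 2^4^[m∸2]≤n^n² = lower , upper
  where
  kQ≤kP+1+m : kQ ≤ kP + suc m
  kQ≤kP+1+m = ldim-split≤ldim+1+ ldimP ldimQ
                (codeword m ⌈ m /2⌉ n≤central) (codewords-separate m ⌈ m /2⌉ n≤central)
  d = kQ ∸ (kP + 3)
  d≤m∸2 : d ≤ m ∸ 2
  d≤m∸2 = ≤-trans (∸-monoˡ-≤ (kP + 3) kQ≤kP+1+m) (≤-reflexive ([m+n]∸[m+o]≡n∸o kP (suc m) 3))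
  lower : 2 ^ (2 ^ (2 * d)) ≤ n ^ (n * n)
  lower = begin
    2 ^ (2 ^ (2 * d))     ≡⟨ cong (2 ^_) (^-*-assoc 2 2 d) ⟨
    2 ^ (4 ^ d)           ≤⟨ ^-monoʳ-≤ 2 (^-monoʳ-≤ 4 d≤m∸2) ⟩
    2 ^ (4 ^ (m ∸ 2))     ≤⟨ 2^4^[m∸2]≤n^n² ⟩
    n ^ (n * n)           ∎
    where open ≤-Reasoning
  upper : kP + 2 ≤ 2 * kQ
  upper = ldim+2≤2*ldim-split ldimP ldimQ (IsPartialOrder.refl po) (Fin.fromℕ< 2≤n)
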